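{- (1) The element $\{1\}$ is a cancellative prime element of $\mathcal P_{\mathrm{fin}}(\mathbb N_0)$, and consequently $\mathcal P_{\mathrm{fin}}(\mathbb N_0)=\{\{k\}\colon k\in\mathbb N_0\}\oplus\mathcal P_{\mathrm{fin},0}(\mathbb N_0)$. No element of $\mathcal P_{\mathrm{fin}}(\mathbb N_0)$ other than $\{1\}$ is prime. (2) If $\mathcal P_{\mathrm{fin},0}(\mathbb N_0)=H_1\oplus H_2$ for submonoids $H_1,H_2$, then $H_1=\{\{0\}\}$ or $H_2=\{\{0\}\}$.
   Context: $\mathcal P_{\mathrm{fin}}(\mathbb N_0)$ is the set of all finite nonempty subsets of $\mathbb N_0$ with set addition $A+B=\{a+b\colon a\in A,b\in B\}$; its identity element is $\{0\}$, which is its only invertible element. $\mathcal P_{\mathrm{fin},0}(\mathbb N_0)$ is the submonoid of those finite nonempty subsets containing $0$. In such a monoid $H$, $A$ divides $B$ if $B=A+C$ for some $C\in H$. An element $P$ is prime if $P\ne\{0\}$ and whenever $P$ divides $A+B$ then $P$ divides $A$ or $P$ divides $B$. An element $A$ is cancellative if $A+B=A+C$ implies $B=C$. For submonoids $H_1,H_2$ of a monoid $H$, $H=H_1\oplus H_2$ means that every element of $H$ can be written uniquely as $h_1+h_2$ with $h_1\in H_1$, $h_2\in H_2$. -}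

module Defs where

open import Data.Nat using (ℕ; zero; suc) renaming (_+_ to _+ℕ_)
open import Data.List using (List; []; _∷_; concatMap; map)
open import Data.List.NonEmpty using (List⁺; _∷_; toList; [_])
open import Data.List.Membership.Propositional using (_∈_)
open import Data.Product using (Σ; ∃; ∃-syntax; _×_; _,_)
open import Data.Sum using (_⊎_)
open import Data.Unit using (⊤)
open import Relation.Nullary using (¬_)

-- A finite nonempty subset of ℕ₀, presented by a nonempty list of its elements.
-- Two presentations denote the same set iff they have the same members (_≈_).
FinSet : Set
FinSet = List⁺ ℕ

_∈ₛ_ : ℕ → FinSet → Set
n ∈ₛ A = n ∈ toList A

_≈_ : FinSet → FinSet → Set
A ≈ B = ∀ n → (n ∈ₛ A → n ∈ₛ B) × (n ∈ₛ B → n ∈ₛ A)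

⟦_⟧ : ℕ → FinSet
⟦ k ⟧ = [ k ]

𝟎 : FinSet
𝟎 = ⟦ 0 ⟧

-- sumset A + B = { a + b | a ∈ A, b ∈ B }
_⊞_ : FinSet → FinSet → FinSet
(a ∷ as) ⊞ B =
  (a +ℕ Data.List.NonEmpty.head B) ∷
    (map (a +ℕ_) (Data.List.NonEmpty.tail B) Data.List.++
     concatMap (λ x → map (x +ℕ_) (toList B)) as)

-- A subset of P_fin(ℕ₀) is a predicate on FinSet (respecting _≈_ where relevant).
Pred : Set₁
Pred = FinSet → Set

Pfin : Pred
Pfin _ = ⊤

Pfin0 : Pred
Pfin0 A = 0 ∈ₛ A

Singletons : Pred
Singletons A = ∃[ k ] (A ≈ ⟦ k ⟧)

_∣[_]_ : FinSet → Pred → FinSet → Set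
A ∣[ H ] B = ∃[ C ] (H C × (B ≈ (A ⊞ C)))

IsPrime : Pred → FinSet → Set
IsPrime H P =
  H P × ¬ (P ≈ 𝟎) ×
  (∀ A B → H A → H B → P ∣[ H ] (A ⊞ B) → (P ∣[ H ] A) ⊎ (P ∣[ H ] B))

IsCancellative : Pred → FinSet → Set
IsCancellative H A = H A × (∀ B C → H B → H C → (A ⊞ B) ≈ (A ⊞ C) → B ≈ C)

IsSubmonoid : Pred → Pred → Set
IsSubmonoid H S =
  (∀ A B → A ≈ B → S A → S B) ×
  (∀ A → S A → H A) ×
  S 𝟎 ×
  (∀ A B → S A → S B → S (A ⊞ B))

IsDirectSum : Pred → Pred → Pred → Set
IsDirectSum H S T =
  (∀ A → H A → ∃[ h₁ ] ∃[ h₂ ] (S h₁ × T h₂ × A ≈ (h₁ ⊞ h₂))) ×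
  (∀ a₁ a₂ b₁ b₂ → S a₁ → T a₂ → S b₁ → T b₂ →
     (a₁ ⊞ a₂) ≈ (b₁ ⊞ b₂) → (a₁ ≈ b₁) × (a₂ ≈ b₂))

IsTrivial : Pred → Set
IsTrivial S = ∀ A → (S A → A ≈ 𝟎) × (A ≈ 𝟎 → S A)

{-# OPTIONS --safe #-}
-- Every A splits uniquely as {min A} + (A − min A) with 0 ∈ A − min A, and {1} divides
-- exactly the sets avoiding 0; this gives the direct sum and the primality of {1}.
-- A singleton {k} with k ≥ 2 divides {1} + {k − 1} but neither summand. If P has least
-- element m and greatest element m + n with n ≥ 1, put N = 2n + 1, X = {m + N} ∪ P,
-- Y = {0} ∪ (N + (P − m)) and Z = Y ∪ {2N}, so that X + Y = P + Z. If X = P + D, then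
-- m + N = p + d forces d > n, so m + d ∈ X exceeds max P and must be m + N; but then
-- m + n + N ∈ X exceeds max X. If Y = P + D, then 0 ∈ Y forces m = 0 and 0 ∈ D, so
-- n ∈ Y, although 0 < n < N.
-- For (2), the atom {0, 1} of P_fin,0 forces one summand, say H₂, to contain {0, 1} and
-- hence every interval [0, n]. For A ∈ H₁ with maximum M, A + [0, M] = [0, 2M] = {0} + [0, 2M],
-- so uniqueness of the decomposition gives A = {0}.

module Submission where

open import Defs
open import Data.Nat using (ℕ; zero; suc; _+_; _∸_; _≤_; _<_; z≤n; s≤s; s≤s⁻¹; _≟_; _≤?_)
open import Data.Nat.Properties
open import Data.Nat.Tactic.RingSolver using (solve-∀)
open import Data.List using ([]; _∷_; map; concatMap; _++_; upTo)
open import Data.List.NonEmpty using (_∷_; toList)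
import Data.List.NonEmpty as List⁺
open import Data.List.Extrema.Nat using (min; max; argmin-sel; argmax-sel; min≤⊤; min≤xs; ⊥≤max; xs≤max)
open import Data.List.Membership.Propositional using (find; lose)
open import Data.List.Membership.Propositional.Properties
  using (∈-map⁺; ∈-map⁻; ∈-concatMap⁺; ∈-concatMap⁻; ∈-++⁺ˡ; ∈-++⁺ʳ; ∈-++⁻; ∈-upTo⁺; ∈-upTo⁻)
open import Data.List.Membership.DecPropositional _≟_ using (_∈?_)
open import Data.List.Relation.Unary.Any using (here; there)
open import Data.List.Relation.Unary.All as All using ()
open import Data.Product using (∃; _×_; _,_; proj₁; proj₂; swap)
open import Data.Sum using (_⊎_; inj₁; inj₂; [_,_]′)
open import Data.Empty using (⊥-elim)
open import Data.Unit using (tt)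
open import Relation.Nullary using (¬_; yes; no; contradiction)
open import Relation.Binary.PropositionalEquality using (_≡_; refl; sym; trans; cong; subst; module ≡-Reasoning)

private
  variable
    A B C D : FinSet
    H S T : Pred
    k x : ℕ

≈-refl : A ≈ A
≈-refl _ = (λ p → p) , (λ p → p)

≈-sym : A ≈ B → B ≈ A
≈-sym A≈B x = proj₂ (A≈B x) , proj₁ (A≈B x)

≈-trans : A ≈ B → B ≈ C → A ≈ C
≈-trans A≈B B≈C x = (λ p → proj₁ (B≈C x) (proj₁ (A≈B x) p)) , (λ p → proj₂ (A≈B x) (proj₂ (B≈C x) p))

∈-resp-≈ : A ≈ B → x ∈ₛ A → x ∈ₛ B
∈-resp-≈ A≈B = proj₁ (A≈B _)

∈-⟦⟧⁻ : x ∈ₛ ⟦ k ⟧ → x ≡ k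
∈-⟦⟧⁻ (here x≡k) = x≡k

⊞-toList : ∀ A B → toList (A ⊞ B) ≡ concatMap (λ a → map (a +_) (toList B)) (toList A)
⊞-toList (_ ∷ _) (_ ∷ _) = refl

∈-⊞⁺ : ∀ A B {a b} → a ∈ₛ A → b ∈ₛ B → (a + b) ∈ₛ (A ⊞ B)
∈-⊞⁺ A B {a} a∈A b∈B rewrite ⊞-toList A B =
  ∈-concatMap⁺ (λ a → map (a +_) (toList B)) (lose a∈A (∈-map⁺ (a +_) b∈B))

∈-⊞⁻ : ∀ A B → x ∈ₛ (A ⊞ B) → ∃ λ a → ∃ λ b → a ∈ₛ A × b ∈ₛ B × x ≡ a + b
∈-⊞⁻ A B x∈A⊞B rewrite ⊞-toList A B
  with a , a∈A , x∈a+B ← find (∈-concatMap⁻ (λ a → map (a +_) (toList B)) x∈A⊞B)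
  with b , b∈B , x≡a+b ← ∈-map⁻ (a +_) x∈a+B
  = a , b , a∈A , b∈B , x≡a+b

∈-⊞⁺′ : ∀ A B {a b} → a ∈ₛ A → b ∈ₛ B → x ≡ a + b → x ∈ₛ (A ⊞ B)
∈-⊞⁺′ A B a∈A b∈B refl = ∈-⊞⁺ A B a∈A b∈B

⊞-cong : A ≈ C → B ≈ D → (A ⊞ B) ≈ (C ⊞ D)
⊞-cong A≈C B≈D _ = ⊆ A≈C B≈D , ⊆ (≈-sym A≈C) (≈-sym B≈D)
  where
  ⊆ : ∀ {A′ B′ C′ D′ y} → A′ ≈ C′ → B′ ≈ D′ → y ∈ₛ (A′ ⊞ B′) → y ∈ₛ (C′ ⊞ D′)
  ⊆ {A′} {B′} {C′} {D′} A′≈C′ B′≈D′ y∈A′⊞B′ with a , b , a∈A′ , b∈B′ , refl ← ∈-⊞⁻ A′ B′ y∈A′⊞B′ =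
    ∈-⊞⁺ C′ D′ (∈-resp-≈ A′≈C′ a∈A′) (∈-resp-≈ B′≈D′ b∈B′)

⊞-comm : ∀ A B → (A ⊞ B) ≈ (B ⊞ A)
⊞-comm A B _ = ⊆ A B , ⊆ B A
  where
  ⊆ : ∀ A′ B′ {y} → y ∈ₛ (A′ ⊞ B′) → y ∈ₛ (B′ ⊞ A′)
  ⊆ A′ B′ y∈A′⊞B′ with a , b , a∈A′ , b∈B′ , refl ← ∈-⊞⁻ A′ B′ y∈A′⊞B′ =
    ∈-⊞⁺′ B′ A′ b∈B′ a∈A′ (+-comm a b)

⊞-identityʳ : ∀ A → (A ⊞ 𝟎) ≈ A
⊞-identityʳ A x = ⊆ , λ x∈A → ∈-⊞⁺′ A 𝟎 x∈A (here refl) (sym (+-identityʳ x))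
  where
  ⊆ : x ∈ₛ (A ⊞ 𝟎) → x ∈ₛ A
  ⊆ x∈A⊞𝟎 with a , _ , a∈A , here refl , refl ← ∈-⊞⁻ A 𝟎 x∈A⊞𝟎 =
    subst (_∈ₛ A) (sym (+-identityʳ a)) a∈A

⊞-identityˡ : ∀ A → (𝟎 ⊞ A) ≈ A
⊞-identityˡ A = ≈-trans (⊞-comm 𝟎 A) (⊞-identityʳ A)

∈-⟦⟧⊞⁻ : ∀ B → x ∈ₛ (⟦ k ⟧ ⊞ B) → ∃ λ b → b ∈ₛ B × x ≡ k + b
∈-⟦⟧⊞⁻ B x∈k+B with _ , b , here refl , b∈B , x≡k+b ← ∈-⊞⁻ ⟦ _ ⟧ B x∈k+B = b , b∈B , x≡k+b

⟦⟧⊞-cancelˡ : ∀ k B C → (⟦ k ⟧ ⊞ B) ≈ (⟦ k ⟧ ⊞ C) → B ≈ C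
⟦⟧⊞-cancelˡ k B C k+B≈k+C x = ⊆ B C k+B≈k+C , ⊆ C B (≈-sym k+B≈k+C)
  where
  ⊆ : ∀ B C → (⟦ k ⟧ ⊞ B) ≈ (⟦ k ⟧ ⊞ C) → x ∈ₛ B → x ∈ₛ C
  ⊆ B C k+B≈k+C x∈B
    with c , c∈C , k+x≡k+c ← ∈-⟦⟧⊞⁻ C (∈-resp-≈ k+B≈k+C (∈-⊞⁺ ⟦ k ⟧ B (here refl) x∈B))
    = subst (_∈ₛ C) (sym (+-cancelˡ-≡ k x c k+x≡k+c)) c∈C

⟦⟧⊞-lowerBound : ∀ B → x ∈ₛ (⟦ k ⟧ ⊞ B) → k ≤ x
⟦⟧⊞-lowerBound {k = k} B x∈k+B with b , _ , refl ← ∈-⟦⟧⊞⁻ B x∈k+B = m≤m+n k b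

shift : ℕ → FinSet → FinSet
shift k = List⁺.map (_∸ k)

∈-shift⁺ : ∀ k A → x ∈ₛ A → (x ∸ k) ∈ₛ shift k A
∈-shift⁺ k (_ ∷ _) = ∈-map⁺ (_∸ k)

∈-shift⁻ : ∀ k A → x ∈ₛ shift k A → ∃ λ a → a ∈ₛ A × x ≡ a ∸ k
∈-shift⁻ k (_ ∷ _) = ∈-map⁻ (_∸ k)

≈-⟦⟧⊞shift : ∀ k A → (∀ {a} → a ∈ₛ A → k ≤ a) → A ≈ (⟦ k ⟧ ⊞ shift k A)
≈-⟦⟧⊞shift k A k≤A x = ⊆ , ⊇
  where
  ⊆ : x ∈ₛ A → x ∈ₛ (⟦ k ⟧ ⊞ shift k A)
  ⊆ x∈A = ∈-⊞⁺′ ⟦ k ⟧ (shift k A) (here refl) (∈-shift⁺ k A x∈A) (sym (m+[n∸m]≡n (k≤A x∈A)))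
  ⊇ : x ∈ₛ (⟦ k ⟧ ⊞ shift k A) → x ∈ₛ A
  ⊇ x∈k+A with b , b∈A-k , refl ← ∈-⟦⟧⊞⁻ (shift k A) x∈k+A
    with a , a∈A , refl ← ∈-shift⁻ k A b∈A-k
    = subst (_∈ₛ A) (sym (m+[n∸m]≡n (k≤A a∈A))) a∈A

min⁺ max⁺ : FinSet → ℕ
min⁺ (a ∷ as) = min a as
max⁺ (a ∷ as) = max a as

min⁺-∈ : ∀ A → min⁺ A ∈ₛ A
min⁺-∈ (a ∷ as) = [ here , there ]′ (argmin-sel (λ x → x) a as)

max⁺-∈ : ∀ A → max⁺ A ∈ₛ A
max⁺-∈ (a ∷ as) = [ here , there ]′ (argmax-sel (λ x → x) a as)

min⁺-≤ : ∀ A → x ∈ₛ A → min⁺ A ≤ x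
min⁺-≤ (a ∷ as) (here refl) = min≤⊤ a as
min⁺-≤ (a ∷ as) (there x∈as) = All.lookup (min≤xs a as) x∈as

≤-max⁺ : ∀ A → x ∈ₛ A → x ≤ max⁺ A
≤-max⁺ (a ∷ as) (here refl) = ⊥≤max a as
≤-max⁺ (a ∷ as) (there x∈as) = All.lookup (xs≤max a as) x∈as

∣⇒∈-≤ : ∀ P → P ∣[ H ] A → x ∈ₛ A → ∃ λ p → p ∈ₛ P × p ≤ x
∣⇒∈-≤ P (C , _ , A≈P⊞C) x∈A with p , c , p∈P , _ , refl ← ∈-⊞⁻ P C (∈-resp-≈ A≈P⊞C x∈A) =
  p , p∈P , m≤m+n p c

⟦1⟧-cancellative : IsCancellative Pfin ⟦ 1 ⟧
⟦1⟧-cancellative = tt , λ B C _ _ → ⟦⟧⊞-cancelˡ 1 B C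

⟦1⟧∣⇒0∉ : ⟦ 1 ⟧ ∣[ H ] A → ¬ (0 ∈ₛ A)
⟦1⟧∣⇒0∉ 1∣A 0∈A with _ , here refl , () ← ∣⇒∈-≤ ⟦ 1 ⟧ 1∣A 0∈A

0∉⇒⟦1⟧∣ : ∀ A → ¬ (0 ∈ₛ A) → ⟦ 1 ⟧ ∣[ Pfin ] A
0∉⇒⟦1⟧∣ A 0∉A = shift 1 A , tt , ≈-⟦⟧⊞shift 1 A 1≤
  where
  1≤ : ∀ {a} → a ∈ₛ A → 1 ≤ a
  1≤ {zero} 0∈A = contradiction 0∈A 0∉A
  1≤ {suc _} _ = s≤s z≤n

⟦1⟧-prime : IsPrime Pfin ⟦ 1 ⟧
⟦1⟧-prime = tt , ⟦1⟧≉𝟎 , ∣-factor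
  where
  ⟦1⟧≉𝟎 : ¬ (⟦ 1 ⟧ ≈ 𝟎)
  ⟦1⟧≉𝟎 1≈0 with () ← ∈-⟦⟧⁻ (∈-resp-≈ 1≈0 (here refl))
  ∣-factor : ∀ A B → Pfin A → Pfin B → ⟦ 1 ⟧ ∣[ Pfin ] (A ⊞ B) →
             (⟦ 1 ⟧ ∣[ Pfin ] A) ⊎ (⟦ 1 ⟧ ∣[ Pfin ] B)
  ∣-factor A B _ _ 1∣A+B with 0 ∈? toList A | 0 ∈? toList B
  ... | no 0∉A  | _       = inj₁ (0∉⇒⟦1⟧∣ A 0∉A)
  ... | yes _   | no 0∉B  = inj₂ (0∉⇒⟦1⟧∣ B 0∉B)
  ... | yes 0∈A | yes 0∈B = ⊥-elim (⟦1⟧∣⇒0∉ 1∣A+B (∈-⊞⁺ A B 0∈A 0∈B))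

⟦⟧⊞-injectiveˡ : ∀ k l A B → 0 ∈ₛ A → 0 ∈ₛ B → (⟦ k ⟧ ⊞ A) ≈ (⟦ l ⟧ ⊞ B) → k ≡ l
⟦⟧⊞-injectiveˡ k l A B 0∈A 0∈B k+A≈l+B =
  ≤-antisym (≤-offset l k B A 0∈B (≈-sym k+A≈l+B)) (≤-offset k l A B 0∈A k+A≈l+B)
  where
  ≤-offset : ∀ k l A B → 0 ∈ₛ A → (⟦ k ⟧ ⊞ A) ≈ (⟦ l ⟧ ⊞ B) → l ≤ k
  ≤-offset k l A B 0∈A k+A≈l+B =
    ⟦⟧⊞-lowerBound B (∈-resp-≈ k+A≈l+B (∈-⊞⁺′ ⟦ k ⟧ A (here refl) 0∈A (sym (+-identityʳ k))))

singletons⊕Pfin0 : IsDirectSum Pfin Singletons Pfin0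
singletons⊕Pfin0 = decompose , unique
  where
  decompose : ∀ A → Pfin A → ∃ λ h₁ → ∃ λ h₂ → Singletons h₁ × Pfin0 h₂ × A ≈ (h₁ ⊞ h₂)
  decompose A _ = ⟦ min⁺ A ⟧ , shift (min⁺ A) A , (min⁺ A , ≈-refl) , 0∈shift ,
                  ≈-⟦⟧⊞shift (min⁺ A) A (min⁺-≤ A)
    where
    0∈shift : 0 ∈ₛ shift (min⁺ A) A
    0∈shift = subst (_∈ₛ shift (min⁺ A) A) (n∸n≡0 (min⁺ A)) (∈-shift⁺ (min⁺ A) A (min⁺-∈ A))
  unique : ∀ a₁ a₂ b₁ b₂ → Singletons a₁ → Pfin0 a₂ → Singletons b₁ → Pfin0 b₂ →
           (a₁ ⊞ a₂) ≈ (b₁ ⊞ b₂) → (a₁ ≈ b₁) × (a₂ ≈ b₂)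
  unique a₁ a₂ b₁ b₂ (k , a₁≈k) 0∈a₂ (l , b₁≈l) 0∈b₂ a≈b =
    ≈-trans a₁≈k (subst (λ j → ⟦ j ⟧ ≈ b₁) (sym k≡l) (≈-sym b₁≈l)) ,
    ⟦⟧⊞-cancelˡ l a₂ b₂ (subst (λ j → (⟦ j ⟧ ⊞ a₂) ≈ (⟦ l ⟧ ⊞ b₂)) k≡l k+a₂≈l+b₂)
    where
    k+a₂≈l+b₂ : (⟦ k ⟧ ⊞ a₂) ≈ (⟦ l ⟧ ⊞ b₂)
    k+a₂≈l+b₂ = ≈-trans (⊞-cong (≈-sym a₁≈k) (≈-refl {a₂})) (≈-trans a≈b (⊞-cong b₁≈l (≈-refl {b₂})))
    k≡l : k ≡ l
    k≡l = ⟦⟧⊞-injectiveˡ k l a₂ b₂ 0∈a₂ 0∈b₂ k+a₂≈l+b₂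

min⁺≡max⁺⇒≈⟦⟧ : ∀ A → min⁺ A ≡ max⁺ A → A ≈ ⟦ min⁺ A ⟧
min⁺≡max⁺⇒≈⟦⟧ A min≡max x = ⊆ , λ x∈min → subst (_∈ₛ A) (sym (∈-⟦⟧⁻ x∈min)) (min⁺-∈ A)
  where
  ⊆ : x ∈ₛ A → x ∈ₛ ⟦ min⁺ A ⟧
  ⊆ x∈A = here (≤-antisym (subst (x ≤_) (sym min≡max) (≤-max⁺ A x∈A)) (min⁺-≤ A x∈A))

⟦⟧∣⇒≤ : ∀ P → P ≈ ⟦ k ⟧ → P ∣[ H ] A → x ∈ₛ A → k ≤ x
⟦⟧∣⇒≤ P P≈k P∣A x∈A with p , p∈P , p≤x ← ∣⇒∈-≤ P P∣A x∈A =
  subst (_≤ _) (∈-⟦⟧⁻ (∈-resp-≈ P≈k p∈P)) p≤x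

prime-singleton≡1 : ∀ P k → P ≈ ⟦ k ⟧ → IsPrime Pfin P → k ≡ 1
prime-singleton≡1 P zero P≈0 (_ , P≉0 , _) = contradiction P≈0 P≉0
prime-singleton≡1 P (suc zero) _ _ = refl
prime-singleton≡1 P (suc (suc k)) P≈k (_ , _ , ∣-factor)
  -- ⟦ 1 ⟧ ⊞ ⟦ suc k ⟧ reduces to ⟦ suc (suc k) ⟧.
  with ∣-factor ⟦ 1 ⟧ ⟦ suc k ⟧ tt tt (𝟎 , tt , ≈-trans (≈-sym P≈k) (≈-sym (⊞-identityʳ P)))
... | inj₁ P∣⟦1⟧   = contradiction (⟦⟧∣⇒≤ P P≈k P∣⟦1⟧ (here refl)) λ { (s≤s ()) }
... | inj₂ P∣⟦1+k⟧ = contradiction (⟦⟧∣⇒≤ P P≈k P∣⟦1+k⟧ (here refl)) (n≮n (suc k))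

module NonSingleton
  (P : FinSet) (m M : ℕ)
  (m∈P : m ∈ₛ P) (m≤ : ∀ {p} → p ∈ₛ P → m ≤ p)
  (M∈P : M ∈ₛ P) (≤M : ∀ {p} → p ∈ₛ P → p ≤ M)
  (m<M : m < M)
  where

  n N : ℕ
  n = M ∸ m
  N = suc (n + n)

  m+n≡M : m + n ≡ M
  m+n≡M = m+[n∸m]≡n (<⇒≤ m<M)

  m+n∈P : (m + n) ∈ₛ P
  m+n∈P = subst (_∈ₛ P) (sym m+n≡M) M∈P

  ≤m+n : ∀ {p} → p ∈ₛ P → p ≤ m + n
  ≤m+n p∈P = subst (_ ≤_) (sym m+n≡M) (≤M p∈P)

  0<n : 0 < n
  0<n = m<n⇒0<n∸m m<M

  raise : ℕ → ℕ
  raise p = N + (p ∸ m)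

  X Y Z : FinSet
  X = (m + N) ∷ toList P
  Y = 0 ∷ map raise (toList P)
  Z = 0 ∷ (map raise (toList P) ++ (N + N) ∷ [])

  m+N+raise : ∀ {p} → m ≤ p → m + N + raise p ≡ p + (N + N)
  m+N+raise {p} m≤p = begin
    m + N + (N + (p ∸ m))   ≡⟨ regroup m N (p ∸ m) ⟩
    (m + (p ∸ m)) + (N + N) ≡⟨ cong (_+ (N + N)) (m+[n∸m]≡n m≤p) ⟩
    p + (N + N)             ∎
    where
    open ≡-Reasoning
    regroup : ∀ m N d → m + N + (N + d) ≡ (m + d) + (N + N)
    regroup = solve-∀

  m+N+0≡m+raise[m] : m + N + 0 ≡ m + raise m
  m+N+0≡m+raise[m] = trans (+-assoc m N 0) (cong (λ d → m + (N + d)) (sym (n∸n≡0 m)))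

  p+d<m+N : ∀ {p d} → p ≤ m + n → d ≤ n → p + d < m + N
  p+d<m+N {p} {d} p≤m+n d≤n = begin-strict
    p + d       ≤⟨ +-mono-≤ p≤m+n d≤n ⟩
    m + n + n   ≡⟨ +-assoc m n n ⟩
    m + (n + n) <⟨ +-monoʳ-< m (n<1+n (n + n)) ⟩
    m + N       ∎
    where open ≤-Reasoning

  X⊞Y≈P⊞Z : (X ⊞ Y) ≈ (P ⊞ Z)
  X⊞Y≈P⊞Z x = ⊆ , ⊇
    where
    ⊆ : x ∈ₛ (X ⊞ Y) → x ∈ₛ (P ⊞ Z)
    ⊆ x∈X⊞Y with ∈-⊞⁻ X Y x∈X⊞Y
    ... | _ , _ , there a∈P , here refl , refl = ∈-⊞⁺ P Z a∈P (here refl)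
    ... | _ , _ , there a∈P , there b∈raise[P] , refl = ∈-⊞⁺ P Z a∈P (there (∈-++⁺ˡ b∈raise[P]))
    ... | _ , _ , here refl , here refl , refl =
      ∈-⊞⁺′ P Z m∈P (there (∈-++⁺ˡ (∈-map⁺ raise m∈P))) m+N+0≡m+raise[m]
    ... | _ , _ , here refl , there b∈raise[P] , refl with p , p∈P , refl ← ∈-map⁻ raise b∈raise[P] =
      ∈-⊞⁺′ P Z p∈P (there (∈-++⁺ʳ (map raise (toList P)) (here refl))) (m+N+raise (m≤ p∈P))
    ⊇ : x ∈ₛ (P ⊞ Z) → x ∈ₛ (X ⊞ Y)
    ⊇ x∈P⊞Z with ∈-⊞⁻ P Z x∈P⊞Z
    ... | _ , _ , p∈P , here refl , refl = ∈-⊞⁺ X Y (there p∈P) (here refl)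
    ... | p , _ , p∈P , there c∈Z , refl with ∈-++⁻ (map raise (toList P)) c∈Z
    ...   | inj₁ c∈raise[P] = ∈-⊞⁺ X Y (there p∈P) (there c∈raise[P])
    ...   | inj₂ (here refl) =
      ∈-⊞⁺′ X Y (here refl) (there (∈-map⁺ raise p∈P)) (sym (m+N+raise (m≤ p∈P)))

  ∈X⇒≡m+N⊎≤m+n : x ∈ₛ X → x ≡ m + N ⊎ x ≤ m + n
  ∈X⇒≡m+N⊎≤m+n (here x≡m+N) = inj₁ x≡m+N
  ∈X⇒≡m+N⊎≤m+n (there x∈P) = inj₂ (≤m+n x∈P)

  ∈Y⇒≡0⊎N≤ : x ∈ₛ Y → x ≡ 0 ⊎ N ≤ x
  ∈Y⇒≡0⊎N≤ (here x≡0) = inj₁ x≡0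
  ∈Y⇒≡0⊎N≤ (there x∈raise[P]) with p , _ , refl ← ∈-map⁻ raise x∈raise[P] = inj₂ (m≤m+n N (p ∸ m))

  P∤X : ¬ (P ∣[ Pfin ] X)
  P∤X (D , _ , X≈P⊞D)
    with p , d , p∈P , d∈D , m+N≡p+d ← ∈-⊞⁻ P D (∈-resp-≈ X≈P⊞D (here refl))
    with ∈X⇒≡m+N⊎≤m+n (∈-resp-≈ (≈-sym X≈P⊞D) (∈-⊞⁺ P D m∈P d∈D))
  ... | inj₂ m+d≤m+n = <⇒≢ (p+d<m+N (≤m+n p∈P) (+-cancelˡ-≤ m d n m+d≤m+n)) (sym m+N≡p+d)
  ... | inj₁ m+d≡m+N with refl ← +-cancelˡ-≡ m d N m+d≡m+N
    with ∈X⇒≡m+N⊎≤m+n (∈-resp-≈ (≈-sym X≈P⊞D) (∈-⊞⁺ P D m+n∈P d∈D))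
  ...   | inj₁ m+n+N≡m+N = >⇒≢ (+-monoˡ-< N (m<m+n m 0<n)) m+n+N≡m+N
  ...   | inj₂ m+n+N≤m+n = m+1+n≰m (m + n) m+n+N≤m+n

  P∤Y : ¬ (P ∣[ Pfin ] Y)
  P∤Y (D , _ , Y≈P⊞D)
    with p , d , p∈P , d∈D , 0≡p+d ← ∈-⊞⁻ P D (∈-resp-≈ Y≈P⊞D (here refl))
    with refl ← m+n≡0⇒m≡0 p (sym 0≡p+d) | refl ← m+n≡0⇒n≡0 p (sym 0≡p+d)
    with ∈Y⇒≡0⊎N≤ (∈-resp-≈ (≈-sym Y≈P⊞D) (∈-⊞⁺ P D m+n∈P d∈D))
  ... | inj₁ m+n+0≡0 = <⇒≢ 0<n (sym (m+n≡0⇒n≡0 m (trans (sym (+-identityʳ (m + n))) m+n+0≡0)))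
  ... | inj₂ N≤m+n+0 = n≮n n (<-≤-trans (s≤s (m≤m+n n n)) (subst (N ≤_) m+n+0≡n N≤m+n+0))
    where
    m+n+0≡n : m + n + 0 ≡ n
    m+n+0≡n = trans (+-identityʳ (m + n)) (cong (_+ n) (n≤0⇒n≡0 (m≤ p∈P)))

  ¬prime : ¬ IsPrime Pfin P
  ¬prime (_ , _ , ∣-factor) = [ P∤X , P∤Y ]′ (∣-factor X Y tt tt (Z , tt , X⊞Y≈P⊞Z))

prime⇒≈⟦1⟧ : ∀ P → IsPrime Pfin P → P ≈ ⟦ 1 ⟧
prime⇒≈⟦1⟧ P P-prime with min⁺ P ≟ max⁺ P
... | yes min≡max = subst (λ k → P ≈ ⟦ k ⟧) (prime-singleton≡1 P (min⁺ P) P≈min P-prime) P≈min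
  where
  P≈min : P ≈ ⟦ min⁺ P ⟧
  P≈min = min⁺≡max⁺⇒≈⟦⟧ P min≡max
... | no min≢max = contradiction P-prime
  (NonSingleton.¬prime P (min⁺ P) (max⁺ P) (min⁺-∈ P) (min⁺-≤ P) (max⁺-∈ P) (≤-max⁺ P)
    (≤∧≢⇒< (≤-max⁺ P (min⁺-∈ P)) min≢max))

interval : ℕ → FinSet
interval n = n ∷ upTo n

∈-interval⁺ : ∀ n → x ≤ n → x ∈ₛ interval n
∈-interval⁺ n x≤n with m≤n⇒m<n∨m≡n x≤n
... | inj₁ x<n = there (∈-upTo⁺ x<n)
... | inj₂ x≡n = here x≡n

∈-interval⁻ : ∀ n → x ∈ₛ interval n → x ≤ n
∈-interval⁻ n (here refl) = ≤-refl
∈-interval⁻ n (there x∈upTo) = <⇒≤ (∈-upTo⁻ x∈upTo)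

⊞-interval : ∀ A M n → 0 ∈ₛ A → M ∈ₛ A → (∀ {a} → a ∈ₛ A → a ≤ M) → M ≤ n →
             (A ⊞ interval n) ≈ interval (M + n)
⊞-interval A M n 0∈A M∈A ≤M M≤n x = ⊆ , ⊇
  where
  ⊆ : x ∈ₛ (A ⊞ interval n) → x ∈ₛ interval (M + n)
  ⊆ x∈A+I with a , i , a∈A , i∈I , refl ← ∈-⊞⁻ A (interval n) x∈A+I =
    ∈-interval⁺ (M + n) (+-mono-≤ (≤M a∈A) (∈-interval⁻ n i∈I))
  ⊇ : x ∈ₛ interval (M + n) → x ∈ₛ (A ⊞ interval n)
  ⊇ x∈I with x ≤? n
  ... | yes x≤n = ∈-⊞⁺ A (interval n) 0∈A (∈-interval⁺ n x≤n)
  ... | no x≰n = ∈-⊞⁺′ A (interval n) M∈A (∈-interval⁺ n (m≤n+o⇒m∸n≤o x M (∈-interval⁻ (M + n) x∈I)))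
                   (sym (m+[n∸m]≡n (≤-trans M≤n (<⇒≤ (≰⇒> x≰n)))))

≈𝟎⁺ : ∀ A → 0 ∈ₛ A → (∀ {x} → x ∈ₛ A → x ≡ 0) → A ≈ 𝟎
≈𝟎⁺ A 0∈A ≡0 x = (λ x∈A → here (≡0 x∈A)) , λ x∈𝟎 → subst (_∈ₛ A) (sym (∈-⟦⟧⁻ x∈𝟎)) 0∈A

interval1-indecomposable : ∀ A B → 0 ∈ₛ A → 0 ∈ₛ B → interval 1 ≈ (A ⊞ B) → A ≈ 𝟎 ⊎ B ≈ 𝟎
interval1-indecomposable A B 0∈A 0∈B I≈A+B with 1 ∈? toList A
... | yes 1∈A = inj₂ (≈𝟎⁺ B 0∈B (λ x∈B → n≤0⇒n≡0 (s≤s⁻¹ (bound (∈-⊞⁺ A B 1∈A x∈B)))))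
  where
  bound : x ∈ₛ (A ⊞ B) → x ≤ 1
  bound x∈A+B = ∈-interval⁻ 1 (∈-resp-≈ (≈-sym I≈A+B) x∈A+B)
... | no 1∉A = inj₁ (≈𝟎⁺ A 0∈A ≡0)
  where
  ≡0 : x ∈ₛ A → x ≡ 0
  ≡0 {x} x∈A with ∈-resp-≈ (≈-sym I≈A+B) (∈-⊞⁺′ A B x∈A 0∈B (sym (+-identityʳ x)))
  ... | here refl = contradiction x∈A 1∉A
  ... | there (here refl) = refl

interval∈submonoid : IsSubmonoid H S → S (interval 1) → ∀ n → S (interval n)
interval∈submonoid (_ , _ , S𝟎 , _) _ zero = S𝟎
interval∈submonoid _ S[0,1] (suc zero) = S[0,1]
interval∈submonoid S-sub@(resp , _ , _ , closed) S[0,1] (suc (suc n)) =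
  resp _ _ (⊞-interval (interval 1) 1 (suc n) (there (here refl)) (here refl) (∈-interval⁻ 1) (s≤s z≤n))
    (closed _ _ S[0,1] (interval∈submonoid S-sub S[0,1] (suc n)))

⊕-comm : IsDirectSum H S T → IsDirectSum H T S
⊕-comm {H} {S} {T} (decompose , unique) = decompose′ , unique′
  where
  decompose′ : ∀ A → H A → ∃ λ h₁ → ∃ λ h₂ → T h₁ × S h₂ × A ≈ (h₁ ⊞ h₂)
  decompose′ A A∈H with s , t , s∈S , t∈T , A≈s+t ← decompose A A∈H =
    t , s , t∈T , s∈S , ≈-trans A≈s+t (⊞-comm s t)
  unique′ : ∀ a₁ a₂ b₁ b₂ → T a₁ → S a₂ → T b₁ → S b₂ → (a₁ ⊞ a₂) ≈ (b₁ ⊞ b₂) → (a₁ ≈ b₁) × (a₂ ≈ b₂)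
  unique′ a₁ a₂ b₁ b₂ a₁∈T a₂∈S b₁∈T b₂∈S a≈b =
    swap (unique a₂ a₁ b₂ b₁ a₂∈S a₁∈T b₂∈S b₁∈T (≈-trans (⊞-comm a₂ a₁) (≈-trans a≈b (⊞-comm b₁ b₂))))

⊕-trivialˡ : IsSubmonoid Pfin0 S → IsSubmonoid Pfin0 T → IsDirectSum Pfin0 S T → T (interval 1) → IsTrivial S
⊕-trivialˡ {S} {T} (resp , S⊆Pfin0 , S𝟎 , _) T-sub (_ , unique) T[0,1] A = A≈𝟎 , λ A≈𝟎 → resp 𝟎 A (≈-sym A≈𝟎) S𝟎
  where
  A≈𝟎 : S A → A ≈ 𝟎
  A≈𝟎 A∈S = proj₁ (unique A (interval M) 𝟎 (interval (M + M)) A∈S (T[0,n] M) S𝟎 (T[0,n] (M + M)) A+I≈𝟎+I)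
    where
    M : ℕ
    M = max⁺ A
    T[0,n] : ∀ n → T (interval n)
    T[0,n] = interval∈submonoid T-sub T[0,1]
    A+I≈𝟎+I : (A ⊞ interval M) ≈ (𝟎 ⊞ interval (M + M))
    A+I≈𝟎+I = ≈-trans (⊞-interval A M M (S⊆Pfin0 A A∈S) (max⁺-∈ A) (≤-max⁺ A) ≤-refl) (≈-sym (⊞-identityˡ _))

Pfin0-indecomposable : ∀ H₁ H₂ → IsSubmonoid Pfin0 H₁ → IsSubmonoid Pfin0 H₂ →
                       IsDirectSum Pfin0 H₁ H₂ → IsTrivial H₁ ⊎ IsTrivial H₂
Pfin0-indecomposable H₁ H₂ H₁-sub@(resp₁ , H₁⊆Pfin0 , _) H₂-sub@(resp₂ , H₂⊆Pfin0 , _) H₁⊕H₂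
  with h₁ , h₂ , h₁∈H₁ , h₂∈H₂ , I≈h₁+h₂ ← proj₁ H₁⊕H₂ (interval 1) (there (here refl))
  with interval1-indecomposable h₁ h₂ (H₁⊆Pfin0 h₁ h₁∈H₁) (H₂⊆Pfin0 h₂ h₂∈H₂) I≈h₁+h₂
... | inj₁ h₁≈𝟎 = inj₁ (⊕-trivialˡ H₁-sub H₂-sub H₁⊕H₂ (resp₂ h₂ (interval 1) h₂≈I h₂∈H₂))
  where
  h₂≈I : h₂ ≈ interval 1
  h₂≈I = ≈-sym (≈-trans I≈h₁+h₂ (≈-trans (⊞-cong h₁≈𝟎 (≈-refl {h₂})) (⊞-identityˡ h₂)))
... | inj₂ h₂≈𝟎 = inj₂ (⊕-trivialˡ H₂-sub H₁-sub (⊕-comm H₁⊕H₂) (resp₁ h₁ (interval 1) h₁≈I h₁∈H₁))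
  where
  h₁≈I : h₁ ≈ interval 1
  h₁≈I = ≈-sym (≈-trans I≈h₁+h₂ (≈-trans (⊞-cong (≈-refl {h₁}) h₂≈𝟎) (⊞-identityʳ h₁)))

theorem3p1 :
    ( IsCancellative Pfin ⟦ 1 ⟧ ×
      IsPrime Pfin ⟦ 1 ⟧ ×
      IsDirectSum Pfin Singletons Pfin0 ×
      (∀ P → IsPrime Pfin P → P ≈ ⟦ 1 ⟧) ) ×
    (∀ H₁ H₂ → IsSubmonoid Pfin0 H₁ → IsSubmonoid Pfin0 H₂ →
      IsDirectSum Pfin0 H₁ H₂ → IsTrivial H₁ ⊎ IsTrivial H₂)
theorem3p1 =
  (⟦1⟧-cancellative , ⟦1⟧-prime , singletons⊕Pfin0 , prime⇒≈⟦1⟧) , Pfin0-indecomposable
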